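{- Let $q\in\{3,4\}$ and $d\ge 1$ be integers, and let $T$ be the complete $q$-ary tree of depth $d$. Then \[\Phi_V(T)\ge d-\log_q(d)-\big(\log_q(2)+1\big).\]
   Context: The complete $q$-ary tree of depth $d$ is the rooted tree in which every vertex at distance less than $d$ from the root has exactly $q$ children, and the vertices at distance $d$ from the root are leaves. For a graph $G$ and $S\subseteq V(G)$, $\delta(S)=\{v\in V(G)\setminus S : N(v)\cap S\neq\emptyset\}$; $\Phi_V(G,s)=\min_{|S|=s}|\delta(S)|$ and $\Phi_V(G)=\max_{0\le s\le |V(G)|}\Phi_V(G,s)$. -}

module Defs where

open import Data.Nat using (ℕ; zero; suc; _+_; _*_; _∸_; _^_; _≤_; _<ᵇ_)
open import Data.Bool using (Bool; true; false; not; _∧_; if_then_else_)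
open import Data.Fin using (Fin)
open import Data.List using (List; []; _∷_; _++_; map; concatMap; allFin; length)
open import Data.Nat.ListAction using (sum)
open import Data.Bool.ListAction using (any)
open import Data.Product using (Σ; _×_; ∃-syntax)
open import Relation.Binary.PropositionalEquality using (_≡_)

-- Complete q-ary tree of depth d.
-- A vertex is a word over Fin q of length ≤ d, written leaf-first:
-- the root is [], and the children of w are  a ∷ w  (a : Fin q).
Word : ℕ → Set
Word q = List (Fin q)

level : (q k : ℕ) → List (Word q)
level q zero    = [] ∷ []
level q (suc k) = concatMap (λ w → map (λ a → a ∷ w) (allFin q)) (level q k)

verts : (q d : ℕ) → List (Word q)
verts q zero    = level q zero
verts q (suc d) = verts q d ++ level q (suc d)

parent : {q : ℕ} → Word q → List (Word q)
parent []      = []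
parent (a ∷ w) = w ∷ []

children : (q d : ℕ) → Word q → List (Word q)
children q d w = if length w <ᵇ d then map (λ a → a ∷ w) (allFin q) else []

nbrs : (q d : ℕ) → Word q → List (Word q)
nbrs q d w = parent w ++ children q d w

-- A subset S ⊆ V(T) is given by its characteristic function
-- (only its values on verts q d matter).
Subset : ℕ → Set
Subset q = Word q → Bool

count : (q d : ℕ) → (Word q → Bool) → ℕ
count q d P = sum (map (λ v → if P v then 1 else 0) (verts q d))

card : (q d : ℕ) → Subset q → ℕ
card q d S = count q d S

bdrySize : (q d : ℕ) → Subset q → ℕ
bdrySize q d S = count q d (λ v → not (S v) ∧ any S (nbrs q d v))

{-# OPTIONS --safe #-}
-- Let s k and b k count the vertices of S and of δ(S) at depth k. A vertex outside S with a child
-- in S lies in δ(S), and every child of a vertex of S lies in S ∪ δ(S); hence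
-- s (k+1) ≤ q (s k + b k) and q s k ≤ s (k+1) + b (k+1). Put p = q − 1. As q ^ k ≡ 1 (mod p),
-- the defect |q ^ k − p t k| of a suitably smoothed level count t k is never 0, and by
-- Bernoulli's inequality it can fall behind q ^ k by one factor q only per boundary vertex:
-- q ^ k ≤ q ^ (b 0 + ⋯ + b (k−1)) · defect k. For |S| = ⌊q ^ (d+1) / p²⌋ the final defect is
-- at most p (1 + |δ(S)|), so q ^ (d − 1 − |δ(S)|) ≤ d.
module Submission where

open import Defs
open import Data.Nat using (ℕ; zero; suc; _+_; _*_; _∸_; _^_; _≤_; _<_; _⊔_; ∣_-_∣; z≤n; s≤s; >-nonZero)
open import Data.Nat.Properties
open import Data.Nat.DivMod using (_/_; _%_; m≡m%n+[m/n]*n; m%n<n; /-monoˡ-≤; m*n/n≡m)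
open import Data.Nat.Divisibility using (divides; ∣m+n∣m⇒∣n; ∣1⇒≡1; m∣m*n)
open import Data.Nat.ListAction using (sum)
open import Data.Nat.ListAction.Properties using (sum-++)
open import Data.Nat.Tactic.RingSolver using (solve-∀)
open import Data.Bool using (Bool; true; false; not; _∧_; _∨_; if_then_else_)
open import Data.Bool.Properties using (∨-zeroʳ; T-≡)
open import Data.Bool.ListAction using (any)
open import Data.List using (List; []; _∷_; _++_; map; concatMap; allFin; length)
open import Data.List.Properties using (map-++; length-map; length-++; length-tabulate)
open import Data.List.Relation.Unary.All as All using (All; []; _∷_)
open import Data.List.Relation.Unary.All.Properties using (map⁺; concat⁺)
open import Data.Product using (Σ; ∃-syntax; _×_; _,_)
open import Data.Sum using (_⊎_; inj₁; inj₂)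
open import Function using (Equivalence)
open import Relation.Nullary using (yes; no; contradiction)
open import Relation.Binary.PropositionalEquality
open import Algebra.Properties.CommutativeSemigroup +-commutativeSemigroup
  using () renaming (interchange to +-interchange)
open import Algebra.Properties.CommutativeSemigroup *-commutativeSemigroup
  using () renaming (x∙yz≈y∙xz to m*[n*o]≡n*[m*o])

indicator : {A : Set} → (A → Bool) → A → ℕ
indicator P x = if P x then 1 else 0

countIn : {A : Set} → (A → Bool) → List A → ℕ
countIn P xs = sum (map (indicator P) xs)

∑< : (ℕ → ℕ) → ℕ → ℕ
∑< f zero    = 0
∑< f (suc k) = ∑< f k + f k

module _ {A : Set} where

  sum-map-+ : (f g : A → ℕ) (xs : List A) →
              sum (map (λ x → f x + g x) xs) ≡ sum (map f xs) + sum (map g xs)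
  sum-map-+ f g []       = refl
  sum-map-+ f g (x ∷ xs) =
    trans (cong (f x + g x +_) (sum-map-+ f g xs)) (+-interchange (f x) (g x) _ _)

  sum-map-*ˡ : (c : ℕ) (f : A → ℕ) (xs : List A) →
               sum (map (λ x → c * f x) xs) ≡ c * sum (map f xs)
  sum-map-*ˡ c f []       = sym (*-zeroʳ c)
  sum-map-*ˡ c f (x ∷ xs) =
    trans (cong (c * f x +_) (sum-map-*ˡ c f xs)) (sym (*-distribˡ-+ c (f x) _))

  sum-map-mono : {f g : A → ℕ} {xs : List A} →
                 All (λ x → f x ≤ g x) xs → sum (map f xs) ≤ sum (map g xs)
  sum-map-mono []           = z≤n
  sum-map-mono (fx≤gx ∷ h) = +-mono-≤ fx≤gx (sum-map-mono h)

  length≤sum-map : (f : A → ℕ) {xs : List A} →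
                   All (λ x → 1 ≤ f x) xs → length xs ≤ sum (map f xs)
  length≤sum-map f []          = z≤n
  length≤sum-map f (1≤fx ∷ h) = +-mono-≤ 1≤fx (length≤sum-map f h)

  countIn≤length : (P : A → Bool) (xs : List A) → countIn P xs ≤ length xs
  countIn≤length P []       = z≤n
  countIn≤length P (x ∷ xs) with P x
  ... | true  = s≤s (countIn≤length P xs)
  ... | false = m≤n⇒m≤1+n (countIn≤length P xs)

  any≡false⇒countIn≡0 : (P : A → Bool) (xs : List A) → any P xs ≡ false → countIn P xs ≡ 0
  any≡false⇒countIn≡0 P []       _ = refl
  any≡false⇒countIn≡0 P (x ∷ xs) h with P x
  ... | false = any≡false⇒countIn≡0 P xs h

  any-++⁺ʳ : (P : A → Bool) (xs : List A) {ys : List A} → any P ys ≡ true → any P (xs ++ ys) ≡ true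
  any-++⁺ʳ P []       h = h
  any-++⁺ʳ P (x ∷ xs) h = trans (cong (P x ∨_) (any-++⁺ʳ P xs h)) (∨-zeroʳ (P x))

  ≤-*-indicator-+ : (P Q : A → Bool) (x : A) {n m : ℕ} →
                    n ≤ m → (P x ≡ false → Q x ≡ false → n ≡ 0) →
                    n ≤ m * (indicator P x + indicator Q x)
  ≤-*-indicator-+ P Q x {n} {m} n≤m vanish with P x | Q x
  ... | true  | _     = ≤-trans n≤m (m≤m*n m (1 + _))
  ... | false | true  = ≤-trans n≤m (m≤m*n m 1)
  ... | false | false = subst (_≤ m * 0) (sym (vanish refl refl)) z≤n

  sum-concatMap : {B : Set} (f : B → ℕ) (g : A → List B) (xs : List A) →
                  sum (map f (concatMap g xs)) ≡ sum (map (λ x → sum (map f (g x))) xs)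
  sum-concatMap f g []       = refl
  sum-concatMap f g (x ∷ xs) = begin
    sum (map f (g x ++ concatMap g xs))
      ≡⟨ cong sum (map-++ f (g x) _) ⟩
    sum (map f (g x) ++ map f (concatMap g xs))
      ≡⟨ sum-++ (map f (g x)) _ ⟩
    sum (map f (g x)) + sum (map f (concatMap g xs))
      ≡⟨ cong (sum (map f (g x)) +_) (sum-concatMap f g xs) ⟩
    sum (map f (g x)) + sum (map (λ x → sum (map f (g x))) xs)
      ∎
    where open ≡-Reasoning

m≤n+o∧n≤m+o⇒∣m-n∣≤o : ∀ {m n o} → m ≤ n + o → n ≤ m + o → ∣ m - n ∣ ≤ o
m≤n+o∧n≤m+o⇒∣m-n∣≤o {m} {n} {o} m≤n+o n≤m+o with ∣m-n∣≡[m∸n]∨[n∸m] m n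
... | inj₁ eq = subst (_≤ o) (sym eq) (m≤n+o⇒m∸n≤o m n m≤n+o)
... | inj₂ eq = subst (_≤ o) (sym eq) (m≤n+o⇒m∸n≤o n m n≤m+o)

*-∣-∣-triangle : ∀ c p a x y → c * ∣ a - p * x ∣ ≤ ∣ c * a - p * y ∣ + p * ∣ y - c * x ∣
*-∣-∣-triangle c p a x y = begin
  c * ∣ a - p * x ∣                           ≡⟨ *-distribˡ-∣-∣ c a (p * x) ⟩
  ∣ c * a - c * (p * x) ∣                     ≡⟨ cong (λ z → ∣ c * a - z ∣) (m*[n*o]≡n*[m*o] c p x) ⟩
  ∣ c * a - p * (c * x) ∣                     ≤⟨ ∣-∣-triangle (c * a) (p * y) (p * (c * x)) ⟩
  ∣ c * a - p * y ∣ + ∣ p * y - p * (c * x) ∣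
    ≡⟨ cong (∣ c * a - p * y ∣ +_) (*-distribˡ-∣-∣ p y (c * x)) ⟨
  ∣ c * a - p * y ∣ + p * ∣ y - c * x ∣       ∎
  where open ≤-Reasoning

bernoulli : ∀ p n → p * n + 1 ≤ suc p ^ n
bernoulli p zero    = ≤-reflexive (cong (_+ 1) (*-zeroʳ p))
bernoulli p (suc n) = begin
  p * suc n + 1              ≡⟨ p*[1+n]+1≡p*n+1+p p n ⟩
  p * n + 1 + p              ≤⟨ +-mono-≤ (bernoulli p n) (m≤m*n p (suc p ^ n) {{m^n≢0 (suc p) n}}) ⟩
  suc p ^ n + p * suc p ^ n  ∎
  where
    open ≤-Reasoning
    p*[1+n]+1≡p*n+1+p : ∀ p n → p * suc n + 1 ≡ p * n + 1 + p
    p*[1+n]+1≡p*n+1+p = solve-∀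

[1+p]^k≡p*N+1 : ∀ p k → ∃[ N ] suc p ^ k ≡ p * N + 1
[1+p]^k≡p*N+1 p zero    = 0 , cong (_+ 1) (sym (*-zeroʳ p))
[1+p]^k≡p*N+1 p (suc k) with [1+p]^k≡p*N+1 p k
... | N , eq = suc (suc p * N) , trans (cong (suc p *_) eq) ([1+p]*[p*N+1]≡p*[1+[1+p]*N]+1 p N)
  where
    [1+p]*[p*N+1]≡p*[1+[1+p]*N]+1 : ∀ p N → suc p * (p * N + 1) ≡ p * suc (suc p * N) + 1
    [1+p]*[p*N+1]≡p*[1+[1+p]*N]+1 = solve-∀

1≤∣[1+p]^k-p*x∣ : ∀ {p} → p ≢ 1 → ∀ k x → 1 ≤ ∣ suc p ^ k - p * x ∣
1≤∣[1+p]^k-p*x∣ {p} p≢1 k x with [1+p]^k≡p*N+1 p k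
... | N , eq = n≢0⇒n>0 λ ∣-∣≡0 →
  let p∣p*N+1 = divides x (trans (sym eq) (trans (∣m-n∣≡0⇒m≡n ∣-∣≡0) (*-comm p x)))
  in p≢1 (∣1⇒≡1 (∣m+n∣m⇒∣n p∣p*N+1 (m∣m*n N)))

module Tree (q : ℕ) where

  allChildren : Word q → List (Word q)
  allChildren w = map (_∷ w) (allFin q)

  length-allChildren : ∀ w → length (allChildren w) ≡ q
  length-allChildren w = trans (length-map (_∷ w) (allFin q)) (length-tabulate _)

  children≡allChildren : ∀ {d} w → length w < d → children q d w ≡ allChildren w
  children≡allChildren {d} w w<d rewrite Equivalence.to T-≡ (<⇒<ᵇ {length w} {d} w<d) = refl

  level-depth : ∀ k → All (λ v → length v ≡ k) (level q k)
  level-depth zero    = refl ∷ []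
  level-depth (suc k) =
    concat⁺ (map⁺ (All.map (λ |w|≡k → map⁺ (All.universal (λ _ → cong suc |w|≡k) (allFin q)))
                           (level-depth k)))

  length-concatMap-allChildren : ∀ ws → length (concatMap allChildren ws) ≡ q * length ws
  length-concatMap-allChildren []       = sym (*-zeroʳ q)
  length-concatMap-allChildren (w ∷ ws) = begin
    length (allChildren w ++ concatMap allChildren ws)          ≡⟨ length-++ (allChildren w) ⟩
    length (allChildren w) + length (concatMap allChildren ws)
      ≡⟨ cong₂ _+_ (length-allChildren w) (length-concatMap-allChildren ws) ⟩
    q + q * length ws                                           ≡⟨ *-suc q (length ws) ⟨
    q * suc (length ws)                                         ∎
    where open ≡-Reasoning

  length-level : ∀ k → length (level q k) ≡ q ^ k
  length-level zero    = refl
  length-level (suc k) = trans (length-concatMap-allChildren (level q k)) (cong (q *_) (length-level k))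

  length-level≤length-verts : ∀ d → length (level q d) ≤ length (verts q d)
  length-level≤length-verts zero    = ≤-refl
  length-level≤length-verts (suc d) =
    subst (length (level q (suc d)) ≤_) (sym (length-++ (verts q d))) (m≤n+m _ _)

  count-by-level : (P : Word q → Bool) → ∀ d →
                   count q d P ≡ ∑< (λ k → countIn P (level q k)) (suc d)
  count-by-level P zero    = refl
  count-by-level P (suc d) = begin
    sum (map (indicator P) (verts q d ++ level q (suc d)))
      ≡⟨ cong sum (map-++ (indicator P) (verts q d) _) ⟩
    sum (map (indicator P) (verts q d) ++ map (indicator P) (level q (suc d)))
      ≡⟨ sum-++ (map (indicator P) (verts q d)) _ ⟩
    count q d P + countIn P (level q (suc d))
      ≡⟨ cong (_+ countIn P (level q (suc d))) (count-by-level P d) ⟩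
    ∑< (λ k → countIn P (level q k)) (suc (suc d))
      ∎
    where open ≡-Reasoning

  countIn-level-suc : ∀ P k →
                      countIn P (level q (suc k)) ≡ sum (map (λ w → countIn P (allChildren w)) (level q k))
  countIn-level-suc P k = sum-concatMap (indicator P) allChildren (level q k)

  module LevelCounts (d : ℕ) (S : Subset q) where

    δ : Word q → Bool
    δ v = not (S v) ∧ any S (nbrs q d v)

    s b : ℕ → ℕ
    s k = countIn S (level q k)
    b k = countIn δ (level q k)

    s₀≤1 : s 0 ≤ 1
    s₀≤1 with S []
    ... | true  = ≤-refl
    ... | false = z≤n

    child-in-S⇒δ : ∀ w → length w < d → S w ≡ false → any S (allChildren w) ≡ true → δ w ≡ true
    child-in-S⇒δ w w<d Sw≡false anyChild rewrite Sw≡false | children≡allChildren w w<d =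
      any-++⁺ʳ S (parent w) anyChild

    countIn-S-children≤q : ∀ w → countIn S (allChildren w) ≤ q
    countIn-S-children≤q w =
      subst (countIn S (allChildren w) ≤_) (length-allChildren w) (countIn≤length S (allChildren w))

    outside-S∪δ⇒no-child-in-S : ∀ w → length w < d → S w ≡ false → δ w ≡ false →
                                any S (allChildren w) ≡ false
    outside-S∪δ⇒no-child-in-S w w<d Sw≡false δw≡false with any S (allChildren w) in anyChild
    ... | false = refl
    ... | true  = contradiction (trans (sym δw≡false) (child-in-S⇒δ w w<d Sw≡false anyChild)) λ ()

    growth-at : ∀ w → length w < d → countIn S (allChildren w) ≤ q * (indicator S w + indicator δ w)
    growth-at w w<d = ≤-*-indicator-+ S δ w (countIn-S-children≤q w) λ Sw δw →
      any≡false⇒countIn≡0 S (allChildren w) (outside-S∪δ⇒no-child-in-S w w<d Sw δw)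

    child-of-S∈S∪δ : ∀ {w} → S w ≡ true → ∀ a → 1 ≤ indicator S (a ∷ w) + indicator δ (a ∷ w)
    child-of-S∈S∪δ {w} Sw≡true a with S (a ∷ w)
    ... | true  = s≤s z≤n
    ... | false rewrite Sw≡true = s≤s z≤n

    spread-at : ∀ w → q * indicator S w ≤ countIn S (allChildren w) + countIn δ (allChildren w)
    spread-at w with S w in Sw
    ... | false = subst (_≤ countIn S (allChildren w) + countIn δ (allChildren w)) (sym (*-zeroʳ q)) z≤n
    ... | true  = begin
      q * 1                                                         ≡⟨ *-identityʳ q ⟩
      q                                                             ≡⟨ length-allChildren w ⟨
      length (allChildren w)
        ≤⟨ length≤sum-map _ (map⁺ (All.universal (child-of-S∈S∪δ Sw) (allFin q))) ⟩
      sum (map (λ v → indicator S v + indicator δ v) (allChildren w))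
        ≡⟨ sum-map-+ (indicator S) (indicator δ) (allChildren w) ⟩
      countIn S (allChildren w) + countIn δ (allChildren w)
        ∎
      where open ≤-Reasoning

    growth : ∀ k → k < d → s (suc k) ≤ q * (s k + b k)
    growth k k<d = begin
      s (suc k)
        ≡⟨ countIn-level-suc S k ⟩
      sum (map (λ w → countIn S (allChildren w)) (level q k))
        ≤⟨ sum-map-mono (All.map below-d (level-depth k)) ⟩
      sum (map (λ w → q * (indicator S w + indicator δ w)) (level q k))
        ≡⟨ sum-map-*ˡ q _ (level q k) ⟩
      q * sum (map (λ w → indicator S w + indicator δ w) (level q k))
        ≡⟨ cong (q *_) (sum-map-+ (indicator S) (indicator δ) (level q k)) ⟩
      q * (s k + b k)
        ∎
      where
        open ≤-Reasoning
        below-d : ∀ {w} → length w ≡ k → countIn S (allChildren w) ≤ q * (indicator S w + indicator δ w)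
        below-d {w} |w|≡k = growth-at w (subst (_< d) (sym |w|≡k) k<d)

    spread : ∀ k → q * s k ≤ s (suc k) + b (suc k)
    spread k = begin
      q * s k
        ≡⟨ sum-map-*ˡ q (indicator S) (level q k) ⟨
      sum (map (λ w → q * indicator S w) (level q k))
        ≤⟨ sum-map-mono (All.universal spread-at (level q k)) ⟩
      sum (map (λ w → inS w + inδ w) (level q k))
        ≡⟨ sum-map-+ inS inδ (level q k) ⟩
      sum (map inS (level q k)) + sum (map inδ (level q k))
        ≡⟨ cong₂ _+_ (countIn-level-suc S k) (countIn-level-suc δ k) ⟨
      s (suc k) + b (suc k)
        ∎
      where
        open ≤-Reasoning
        inS inδ : Word q → ℕ
        inS w = countIn S (allChildren w)
        inδ w = countIn δ (allChildren w)

-- The argument needs p ≢ 1 and q ≤ p * p, i.e. q ≥ 3.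
module Arity≥3 (r : ℕ) where

  p q : ℕ
  p = 2 + r
  q = suc p

  -- Bernoulli gives q ^ (1 + k) * (p * n + 1) ≤ q ^ (B + n) * (D′ + p * (q * n)); when B + n ≤ k,
  -- the surplus q ^ (B + n) * (p * (q * n)) is at most q ^ (1 + k) * (p * n), which cancels.
  absorb : ∀ {k B n D D′} → q ^ k ≤ q ^ B * D → q * D ≤ D′ + p * (q * n) → 1 ≤ D′ →
           q ^ suc k ≤ q ^ (B + n) * D′
  absorb {k} {B} {n} {D} {D′} q^k≤ qD≤ 1≤D′ with suc k ≤? B + n
  ... | yes 1+k≤B+n = ≤-trans (^-monoʳ-≤ q 1+k≤B+n) (m≤m*n (q ^ (B + n)) D′ {{>-nonZero 1≤D′}})
  ... | no  1+k≰B+n = +-cancelˡ-≤ surplus _ _ (begin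
      surplus + q ^ suc k                     ≡⟨ a*b+a≡a*[b+1] (q ^ suc k) (p * n) ⟩
      q ^ suc k * (p * n + 1)                 ≤⟨ *-monoʳ-≤ (q ^ suc k) (bernoulli p n) ⟩
      q ^ suc k * q ^ n                       ≤⟨ *-monoˡ-≤ (q ^ n) (*-monoʳ-≤ q q^k≤) ⟩
      q * (q ^ B * D) * q ^ n                 ≡⟨ regroup q (q ^ B) D (q ^ n) ⟩
      q ^ B * q ^ n * (q * D)                 ≡⟨ cong (_* (q * D)) (^-distribˡ-+-* q B n) ⟨
      q ^ (B + n) * (q * D)                   ≤⟨ *-monoʳ-≤ (q ^ (B + n)) qD≤ ⟩
      q ^ (B + n) * (D′ + p * (q * n))        ≡⟨ *-distribˡ-+ (q ^ (B + n)) D′ _ ⟩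
      q ^ (B + n) * D′ + q ^ (B + n) * (p * (q * n))
        ≡⟨ cong (q ^ (B + n) * D′ +_) (regroup′ (q ^ (B + n)) p q n) ⟩
      q ^ (B + n) * D′ + q ^ suc (B + n) * (p * n)
        ≤⟨ +-monoʳ-≤ _ (*-monoˡ-≤ (p * n) (^-monoʳ-≤ q (≰⇒> 1+k≰B+n))) ⟩
      q ^ (B + n) * D′ + surplus              ≡⟨ +-comm _ surplus ⟩
      surplus + q ^ (B + n) * D′              ∎)
    where
      open ≤-Reasoning
      surplus = q ^ suc k * (p * n)
      a*b+a≡a*[b+1] : ∀ a b → a * b + a ≡ a * (b + 1)
      a*b+a≡a*[b+1] = solve-∀
      regroup : ∀ a b c e → a * (b * c) * e ≡ b * e * (a * c)
      regroup = solve-∀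
      regroup′ : ∀ a p q n → a * (p * (q * n)) ≡ q * a * (p * n)
      regroup′ = solve-∀

  exponent-bound : ∀ {d B} → 1 ≤ d → q ^ d ≤ q ^ B * (p * suc B) → q ^ (d ∸ suc B) ≤ d
  exponent-bound {d} {B} 1≤d q^d≤ with d ≤? suc B
  ... | yes d≤1+B = subst (λ e → q ^ e ≤ d) (sym (m≤n⇒m∸n≡0 d≤1+B)) 1≤d
  ... | no  d≰1+B = ≤-trans q^e≤1+B (<⇒≤ (≰⇒> d≰1+B))
    where
      open ≤-Reasoning
      e = d ∸ suc B
      q^e≤1+B : q ^ e ≤ suc B
      q^e≤1+B = *-cancelˡ-≤ q (*-cancelˡ-≤ (q ^ B) {{m^n≢0 q B}} (begin
        q ^ B * q ^ suc e   ≡⟨ ^-distribˡ-+-* q B (suc e) ⟨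
        q ^ (B + suc e)     ≡⟨ cong (q ^_) (trans (+-suc B e) (m+[n∸m]≡n (<⇒≤ (≰⇒> d≰1+B)))) ⟩
        q ^ d               ≤⟨ q^d≤ ⟩
        q ^ B * (p * suc B) ≤⟨ *-monoʳ-≤ (q ^ B) (*-monoˡ-≤ (suc B) (n≤1+n p)) ⟩
        q ^ B * (q * suc B) ∎))

  ⌊q^[1+d]/p²⌋≤q^d : ∀ d → q ^ suc d / (p * p) ≤ q ^ d
  ⌊q^[1+d]/p²⌋≤q^d d = begin
    q ^ suc d / (p * p)         ≤⟨ /-monoˡ-≤ (p * p) q^[1+d]≤q^d*p² ⟩
    q ^ d * (p * p) / (p * p)   ≡⟨ m*n/n≡m (q ^ d) (p * p) ⟩
    q ^ d                       ∎
    where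
      open ≤-Reasoning
      expand : ∀ r → (2 + r) * (2 + r) ≡ (3 + r) + (1 + 3 * r + r * r)
      expand = solve-∀
      q≤p*p : q ≤ p * p
      q≤p*p = subst (q ≤_) (sym (expand r)) (m≤m+n q _)
      q^[1+d]≤q^d*p² : q ^ suc d ≤ q ^ d * (p * p)
      q^[1+d]≤q^d*p² = subst (_≤ q ^ d * (p * p)) (*-comm (q ^ d) q) (*-monoʳ-≤ (q ^ d) q≤p*p)

  module LevelSequences (s b : ℕ → ℕ) (d : ℕ)
    (growth : ∀ k → k < d → s (suc k) ≤ q * (s k + b k))
    (spread : ∀ k → q * s k ≤ s (suc k) + b (suc k))
    (s₀≤1 : s 0 ≤ 1) where

    -- Against s itself, q * s k − s (1 + k) is charged to b (1 + k); replacing s (1 + k) by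
    -- t (1 + k) charges both signs of t (1 + k) − q * t k to b k alone.
    t : ℕ → ℕ
    t zero    = s 0
    t (suc k) = s (suc k) ⊔ q * s k

    s≤t : ∀ k → s k ≤ t k
    s≤t zero    = ≤-refl
    s≤t (suc k) = m≤m⊔n _ _

    t≤s+b : ∀ k → t k ≤ s k + b k
    t≤s+b zero    = m≤m+n _ _
    t≤s+b (suc k) = ⊔-lub (m≤m+n _ _) (spread k)

    t-growth : ∀ k → k < d → t (suc k) ≤ q * t k + q * b k
    t-growth k k<d = ⊔-lub
      (≤-trans (growth k k<d)
        (≤-trans (*-monoʳ-≤ q (+-monoˡ-≤ (b k) (s≤t k))) (≤-reflexive (*-distribˡ-+ q (t k) (b k)))))
      (≤-trans (*-monoʳ-≤ q (s≤t k)) (m≤m+n _ _))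

    t-decay : ∀ k → q * t k ≤ t (suc k) + q * b k
    t-decay zero    = ≤-trans (m≤n⊔m (s 1) (q * s 0)) (m≤m+n _ _)
    t-decay (suc k) = subst (_≤ t (suc (suc k)) + q * b (suc k)) (sym (*-distribˡ-⊔ q (s (suc k)) (q * s k)))
      (⊔-lub (≤-trans (m≤n⊔m (s (suc (suc k))) (q * s (suc k))) (m≤m+n _ _)) (begin
        q * (q * s k)                   ≤⟨ *-monoʳ-≤ q (spread k) ⟩
        q * (s (suc k) + b (suc k))     ≡⟨ *-distribˡ-+ q (s (suc k)) (b (suc k)) ⟩
        q * s (suc k) + q * b (suc k)   ≤⟨ +-monoˡ-≤ _ (m≤n⊔m (s (suc (suc k))) (q * s (suc k))) ⟩
        t (suc (suc k)) + q * b (suc k) ∎))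
      where open ≤-Reasoning

    defect : ℕ → ℕ
    defect k = ∣ q ^ k - p * t k ∣

    defect-step : ∀ k → k < d → q * defect k ≤ defect (suc k) + p * (q * b k)
    defect-step k k<d = ≤-trans (*-∣-∣-triangle q p (q ^ k) (t k) (t (suc k)))
      (+-monoʳ-≤ (defect (suc k)) (*-monoʳ-≤ p (m≤n+o∧n≤m+o⇒∣m-n∣≤o (t-growth k k<d) (t-decay k))))

    1≤defect : ∀ k → 1 ≤ defect k
    1≤defect k = 1≤∣[1+p]^k-p*x∣ {p} (λ ()) k (t k)

    q^k≤q^∑b*defect : ∀ k → k ≤ d → q ^ k ≤ q ^ ∑< b k * defect k
    q^k≤q^∑b*defect zero    _     = ≤-trans (1≤defect 0) (≤-reflexive (sym (*-identityˡ _)))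
    q^k≤q^∑b*defect (suc k) 1+k≤d =
      absorb {k} {∑< b k} {b k} (q^k≤q^∑b*defect k (<⇒≤ 1+k≤d)) (defect-step k 1+k≤d) (1≤defect (suc k))

    -- W k − q * s k telescopes to the sum over j < k of q * s j − s (1 + j).
    W : ℕ → ℕ
    W k = p * ∑< s (suc k) + s 0

    W≤q*s+∑b : ∀ k → W k ≤ q * s k + ∑< b (suc k)
    W≤q*s+∑b zero    = ≤-trans (≤-reflexive (p*[0+x]+x≡[1+p]*x p (s 0))) (m≤m+n _ _)
      where
        p*[0+x]+x≡[1+p]*x : ∀ p x → p * (0 + x) + x ≡ (1 + p) * x
        p*[0+x]+x≡[1+p]*x = solve-∀
    W≤q*s+∑b (suc k) = begin
      W (suc k)                                           ≡⟨ regroup p (∑< s (suc k)) (s (suc k)) (s 0) ⟩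
      W k + p * s (suc k)                                 ≤⟨ +-monoˡ-≤ _ (W≤q*s+∑b k) ⟩
      q * s k + ∑< b (suc k) + p * s (suc k)              ≤⟨ +-monoˡ-≤ _ (+-monoˡ-≤ _ (spread k)) ⟩
      s (suc k) + b (suc k) + ∑< b (suc k) + p * s (suc k)
        ≡⟨ regroup′ p (s (suc k)) (b (suc k)) (∑< b (suc k)) ⟩
      q * s (suc k) + ∑< b (suc (suc k))                  ∎
      where
        open ≤-Reasoning
        regroup : ∀ p A x s₀ → p * (A + x) + s₀ ≡ (p * A + s₀) + p * x
        regroup = solve-∀
        regroup′ : ∀ p x y B → x + y + B + p * x ≡ (1 + p) * x + (B + y)
        regroup′ = solve-∀

    q*s≤W+q*∑b : ∀ k → k ≤ d → q * s k ≤ W k + q * ∑< b k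
    q*s≤W+q*∑b zero    _     = ≤-reflexive ([1+p]*x≡p*[0+x]+x+[1+p]*0 p (s 0))
      where
        [1+p]*x≡p*[0+x]+x+[1+p]*0 : ∀ p x → (1 + p) * x ≡ p * (0 + x) + x + (1 + p) * 0
        [1+p]*x≡p*[0+x]+x+[1+p]*0 = solve-∀
    q*s≤W+q*∑b (suc k) 1+k≤d = begin
      s (suc k) + p * s (suc k)                    ≤⟨ +-monoˡ-≤ _ (growth k 1+k≤d) ⟩
      q * (s k + b k) + p * s (suc k)              ≡⟨ cong (_+ p * s (suc k)) (*-distribˡ-+ q (s k) (b k)) ⟩
      q * s k + q * b k + p * s (suc k)
        ≤⟨ +-monoˡ-≤ _ (+-monoˡ-≤ _ (q*s≤W+q*∑b k (<⇒≤ 1+k≤d))) ⟩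
      W k + q * ∑< b k + q * b k + p * s (suc k)
        ≡⟨ regroup p (∑< s (suc k)) (s (suc k)) (s 0) (∑< b k) (b k) ⟩
      W (suc k) + q * ∑< b (suc k)                 ∎
      where
        open ≤-Reasoning
        regroup : ∀ p A x s₀ B y → p * A + s₀ + (1 + p) * B + (1 + p) * y + p * x
                                   ≡ p * (A + x) + s₀ + (1 + p) * (B + y)
        regroup = solve-∀

    ∣W-q*t∣≤q*∑b : ∣ W d - q * t d ∣ ≤ q * ∑< b (suc d)
    ∣W-q*t∣≤q*∑b = m≤n+o∧n≤m+o⇒∣m-n∣≤o
      (≤-trans (W≤q*s+∑b d) (+-mono-≤ (*-monoʳ-≤ q (s≤t d)) (m≤n*m _ q)))
      (begin
        q * t d                       ≤⟨ *-monoʳ-≤ q (t≤s+b d) ⟩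
        q * (s d + b d)               ≡⟨ *-distribˡ-+ q (s d) (b d) ⟩
        q * s d + q * b d             ≤⟨ +-monoˡ-≤ _ (q*s≤W+q*∑b d ≤-refl) ⟩
        W d + q * ∑< b d + q * b d    ≡⟨ +-assoc (W d) _ _ ⟩
        W d + (q * ∑< b d + q * b d)  ≡⟨ cong (W d +_) (*-distribˡ-+ q (∑< b d) (b d)) ⟨
        W d + q * ∑< b (suc d)        ∎)
      where open ≤-Reasoning

    ∣q^[1+d]-p*W∣≤p*p+p : ∑< s (suc d) ≡ q ^ suc d / (p * p) → ∣ q ^ suc d - p * W d ∣ ≤ p * p + p
    ∣q^[1+d]-p*W∣≤p*p+p ∑s≡ = begin
      ∣ q ^ suc d - p * W d ∣                      ≡⟨ cong₂ ∣_-_∣ q^[1+d]≡ p*W≡ ⟩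
      ∣ quot * (p * p) + rem - quot * (p * p) + p * s 0 ∣
        ≡⟨ ∣m+n-m+o∣≡∣n-o∣ (quot * (p * p)) rem (p * s 0) ⟩
      ∣ rem - p * s 0 ∣                            ≤⟨ ∣m-n∣≤m⊔n rem (p * s 0) ⟩
      rem ⊔ p * s 0                                ≤⟨ m⊔n≤m+n rem (p * s 0) ⟩
      rem + p * s 0
        ≤⟨ +-mono-≤ (<⇒≤ (m%n<n (q ^ suc d) (p * p))) (*-monoʳ-≤ p s₀≤1) ⟩
      p * p + p * 1                                ≡⟨ cong (p * p +_) (*-identityʳ p) ⟩
      p * p + p                                    ∎
      where
        open ≤-Reasoning
        quot = q ^ suc d / (p * p)
        rem  = q ^ suc d % (p * p)
        q^[1+d]≡ : q ^ suc d ≡ quot * (p * p) + rem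
        q^[1+d]≡ = trans (m≡m%n+[m/n]*n (q ^ suc d) (p * p)) (+-comm rem _)
        regroup : ∀ p x y → p * (p * x + y) ≡ x * (p * p) + p * y
        regroup = solve-∀
        p*W≡ : p * W d ≡ quot * (p * p) + p * s 0
        p*W≡ = trans (cong (λ x → p * (p * x + s 0)) ∑s≡) (regroup p quot (s 0))

    q^d≤q^∑b*p[1+∑b] : ∑< s (suc d) ≡ q ^ suc d / (p * p) →
                       q ^ d ≤ q ^ ∑< b (suc d) * (p * suc (∑< b (suc d)))
    q^d≤q^∑b*p[1+∑b] ∑s≡ = ≤-trans (q^k≤q^∑b*defect d ≤-refl)
      (*-mono-≤ (^-monoʳ-≤ q (m≤m+n (∑< b d) (b d))) (*-cancelˡ-≤ q (begin
        q * defect d                                           ≤⟨ *-∣-∣-triangle q p (q ^ d) (t d) (W d) ⟩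
        ∣ q ^ suc d - p * W d ∣ + p * ∣ W d - q * t d ∣
          ≤⟨ +-mono-≤ (∣q^[1+d]-p*W∣≤p*p+p ∑s≡) (*-monoʳ-≤ p ∣W-q*t∣≤q*∑b) ⟩
        p * p + p + p * (q * B)                                ≡⟨ regroup p B ⟩
        q * (p * suc B)                                        ∎)))
      where
        open ≤-Reasoning
        B = ∑< b (suc d)
        regroup : ∀ p B → p * p + p + p * ((1 + p) * B) ≡ (1 + p) * (p * (1 + B))
        regroup = solve-∀

  open Tree q

  vertex-boundary-bound : ∀ d → 1 ≤ d →
    Σ ℕ (λ s → (s ≤ length (verts q d)) ×
      ((S : Subset q) → card q d S ≡ s → q ^ (d ∸ suc (bdrySize q d S)) ≤ 2 * d))
  vertex-boundary-bound d 1≤d = q ^ suc d / (p * p) , s*≤|V| , bound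
    where
      s*≤|V| : q ^ suc d / (p * p) ≤ length (verts q d)
      s*≤|V| = ≤-trans (⌊q^[1+d]/p²⌋≤q^d d)
                 (subst (_≤ length (verts q d)) (length-level d) (length-level≤length-verts d))

      bound : (S : Subset q) → card q d S ≡ q ^ suc d / (p * p) → q ^ (d ∸ suc (bdrySize q d S)) ≤ 2 * d
      bound S |S|≡s* = subst (λ B → q ^ (d ∸ suc B) ≤ 2 * d) (sym (count-by-level δ d))
        (≤-trans (exponent-bound 1≤d (q^d≤q^∑b*p[1+∑b] (trans (sym (count-by-level S d)) |S|≡s*)))
                 (m≤n*m d 2))
        where
          open LevelCounts d S
          open LevelSequences s b d growth spread s₀≤1

theorem3p2 : (q d : ℕ) → (q ≡ 3 ⊎ q ≡ 4) → 1 ≤ d →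
    Σ ℕ (λ s → (s ≤ length (verts q d)) ×
    ((S : Subset q) → card q d S ≡ s →
    q ^ (d ∸ suc (bdrySize q d S)) ≤ 2 * d))
theorem3p2 .3 d (inj₁ refl) = Arity≥3.vertex-boundary-bound 0 d
theorem3p2 .4 d (inj₂ refl) = Arity≥3.vertex-boundary-bound 1 d
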